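{- Let $S$ and $R$ be sock orderings where $S$ contains at least two distinct colors and contains no sandwich. Let $a$ be a color in $S$ that is not the top color of $S$, and let $S'$ be obtained from $S$ by removing all socks of color $a$. If a color $x$ is unsortable in $(S,R)$ and sortable in $(S',R)$, then at least one of the following holds: (1) $x=a$; (2) $ax\subseteq R$; (3) there is a color $y$ distinct from $a$ and $x$ such that $yx\subseteq R$ and the top three colors of the stack $S$ are, from bottom to top, $y$, $a$, $x$.
   Context: Sock orderings are finite words of colored socks written as words over colors; $Y\subseteq X$ means $Y$ is a subsequence of $X$. A state $(S,R)$ of foot-sorting has stack content $S$ (left to right = bottom to top) and remaining input $R$. A sandwich is a word $uvu$ with colors $u\ne v$; it blocks a color $z\notin\{u,v\}$ in a word $W$ if $uvuz\subseteq W$. Since $S$ contains no sandwich, the socks of each color in $S$ are consecutive, and "the top colors of $S$" refers to the colors of these blocks from the top. A color $x$ occurring in $SR$ is sortable in $(S,R)$ if (1) no sock of a color other than $x$ lies above a sock of color $x$ in $S$ (i.e. $xw\not\subseteq S$ for every color $w\ne x$), and (2) if $x$ occurs in $R$, then $x$ is not blocked by any sandwich in $SR$; otherwise $x$ is unsortable. -}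

module Defs where

open import Data.List using (List; []; _∷_; _++_; [_]; filter; replicate)
open import Data.List.Membership.Propositional using (_∈_)
open import Data.List.Relation.Binary.Sublist.Propositional using (_⊆_)
open import Data.Nat using (ℕ; suc)
open import Data.Product using (Σ; ∃; _×_; _,_)
open import Relation.Nullary using (¬_)
open import Relation.Binary.PropositionalEquality using (_≡_; _≢_)

-- A stack S is written left to right = bottom to top, so the top sock is the
-- last element of the list.

module _ {C : Set} where

  ContainsSandwich : List C → Set
  ContainsSandwich W = ∃ λ u → ∃ λ v → u ≢ v × (u ∷ v ∷ u ∷ []) ⊆ W

  Blocked : C → List C → Set
  Blocked z W = ∃ λ u → ∃ λ v →
    u ≢ v × z ≢ u × z ≢ v × (u ∷ v ∷ u ∷ z ∷ []) ⊆ W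

  Sortable : C → List C → List C → Set
  Sortable x S R =
    x ∈ (S ++ R)
    × (∀ w → w ≢ x → ¬ ((x ∷ w ∷ []) ⊆ S))
    × (x ∈ R → ¬ Blocked x (S ++ R))

  Unsortable : C → List C → List C → Set
  Unsortable x S R = x ∈ (S ++ R) × ¬ Sortable x S R

  TwoColors : List C → Set
  TwoColors S = ∃ λ c → ∃ λ d → c ≢ d × c ∈ S × d ∈ S

  TopColor : C → List C → Set
  TopColor a S = ∃ λ T → S ≡ T ++ [ a ]

  -- the top three colour blocks of S are, from bottom to top, y, a, x
  -- (used with y, a, x pairwise distinct)
  TopThree : C → C → C → List C → Set
  TopThree y a x S = ∃ λ T → ∃ λ k → ∃ λ l → ∃ λ m →
    S ≡ T ++ replicate (suc k) y ++ replicate (suc l) a ++ replicate (suc m) x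

{-# OPTIONS --safe #-}
module Submission where

open import Defs
open import Data.List using (List; filter)
open import Data.List.Membership.Propositional using (_∈_)
open import Data.List.Relation.Binary.Sublist.Propositional using (_⊆_)
open import Data.List using (_∷_; [])
open import Data.Product using (∃; _×_)
open import Data.Sum using (_⊎_)
open import Relation.Nullary using (¬_; ¬?)
open import Relation.Binary.Definitions using (DecidableEquality)
open import Relation.Binary.PropositionalEquality using (_≡_; _≢_)

open import Data.Empty using (⊥-elim)
open import Data.List using (_++_; [_]; replicate; reverse; length; initLast; _∷ʳ′_)
open import Data.List.Properties using (filter-all; filter-++; reverse-++; ++-assoc; ++-identityʳ)
open import Data.List.Membership.Propositional using (lose)
open import Data.List.Relation.Binary.Sublist.Propositional
  using ([]; _∷_; _∷ʳ_; ⊆-refl; ⊆-trans; lookup; from∈; to∈)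
open import Data.List.Relation.Binary.Sublist.Propositional.Properties
  using (++⁺; ++⁺ˡ; ∷ˡ⁻; ∷ʳ⁻; reverse⁺; reverse⁻; filter⁺; filter-⊆)
open import Data.List.Relation.Unary.All as All using (All; []; _∷_)
open import Data.List.Relation.Unary.All.Properties using (replicate⁺) renaming (++⁺ to All-++⁺)
open import Data.List.Relation.Unary.Any using (here; there; any?; satisfied)
open import Data.Nat using (ℕ; zero; suc)
open import Data.Product using (_,_; ∃₂; curry)
open import Data.Sum using (inj₁; inj₂)
open import Function using (_∘_)
open import Relation.Nullary using (Dec; yes; no)
open import Relation.Nullary.Decidable using (_×-dec_; map′; decidable-stable)
open import Relation.Binary.PropositionalEquality using (refl; sym; trans; cong; subst; subst₂; ≢-sym)
open import Relation.Unary using (Decidable)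

-- If a lies above x in S, then, a not being on top, some sock t ≠ a lies above that a;
-- t = x gives the sandwich x a x, and otherwise t lies above x also in S′. So erasing a
-- cannot uncover x, and x must be blocked in SR by a sandwich u v u that disappears in
-- S′R, i.e. u = a or v = a. Since S has no sandwich, at most the part u v of u v u x lies
-- in S, which yields a x ⊆ R unless y a ⊆ S and y x ⊆ R (v = a, u = y). In that case the
-- socks above that y have colors y, a, x only (another color w would give the sandwich
-- y w y blocking x in S′R), and a sandwich-free S with x exposed forces them into blocks
-- y* a⁺ x*, where x* is nonempty because a is not on top.

module _ {A : Set} where

  ⊆-++-split : (S : List A) {R L : List A} → L ⊆ S ++ R →
    ∃₂ λ L₁ L₂ → L ≡ L₁ ++ L₂ × L₁ ⊆ S × L₂ ⊆ R
  ⊆-++-split [] p = [] , _ , refl , [] , p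
  ⊆-++-split (s ∷ S) (_ ∷ʳ p) =
    let L₁ , L₂ , eq , q₁ , q₂ = ⊆-++-split S p in L₁ , L₂ , eq , s ∷ʳ q₁ , q₂
  ⊆-++-split (s ∷ S) (refl ∷ p) =
    let L₁ , L₂ , eq , q₁ , q₂ = ⊆-++-split S p in s ∷ L₁ , L₂ , cong (s ∷_) eq , refl ∷ q₁ , q₂

  ∷-⊆-split : {y : A} {ys S : List A} → (y ∷ ys) ⊆ S →
    ∃₂ λ T Rest → S ≡ T ++ y ∷ Rest × ys ⊆ Rest
  ∷-⊆-split (s ∷ʳ p) = let T , Rest , eq , q = ∷-⊆-split p in s ∷ T , Rest , cong (s ∷_) eq , q
  ∷-⊆-split (refl ∷ p) = [] , _ , refl , p

  ∷ʳ-⊆-∷ʳ⁻ : {xs T : List A} {y t : A} → y ≢ t → xs ++ [ y ] ⊆ T ++ [ t ] → xs ++ [ y ] ⊆ T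
  ∷ʳ-⊆-∷ʳ⁻ {xs} {T} {y} {t} y≢t p = reverse⁻ (subst (_⊆ reverse T) (sym (reverse-++ xs [ y ]))
    (∷ʳ⁻ y≢t (subst₂ _⊆_ (reverse-++ xs [ y ]) (reverse-++ T [ t ]) (reverse⁺ p))))

  ∃-∈? : {P : A → Set} (W : List A) → Decidable P → (∀ {u} → P u → u ∈ W) → Dec (∃ P)
  ∃-∈? W P? bound = map′ satisfied (λ (u , pu) → lose (bound pu) pu) (any? P? W)

  All≡⇒replicate : {x : A} {L : List A} → All (_≡ x) L → L ≡ replicate (length L) x
  All≡⇒replicate [] = refl
  All≡⇒replicate (refl ∷ ps) = cong (_ ∷_) (All≡⇒replicate ps)

  replicate-prefix : {c : A} {P : A → Set} {L : List A} → All (λ w → w ≡ c ⊎ P w) L →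
    (∀ {w} → P w → ¬ (w ∷ c ∷ []) ⊆ L) →
    ∃₂ λ i L′ → L ≡ replicate i c ++ L′ × All P L′
  replicate-prefix [] _ = 0 , [] , refl , []
  replicate-prefix (inj₁ refl ∷ ws) not-before =
    let i , L′ , eq , ps = replicate-prefix ws (λ pw → not-before pw ∘ (_ ∷ʳ_))
    in suc i , L′ , cong (_ ∷_) eq , ps
  replicate-prefix {P = P} (inj₂ pw ∷ ws) not-before = 0 , _ , refl , pw ∷ All.tabulate resolve
    where
    resolve : ∀ {v} → v ∈ _ → P v
    resolve v∈L with All.lookup ws v∈L
    ... | inj₁ refl = ⊥-elim (not-before pw (refl ∷ from∈ v∈L))
    ... | inj₂ pv = pv

  three-blocks : {u a x : A} {L : List A} → All (λ w → w ≡ u ⊎ w ≡ a ⊎ w ≡ x) L →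
    ¬ (a ∷ u ∷ []) ⊆ L → ¬ (x ∷ u ∷ []) ⊆ L → ¬ (x ∷ a ∷ []) ⊆ L →
    ∃₂ λ i j → ∃ λ k → L ≡ replicate i u ++ replicate j a ++ replicate k x
  three-blocks {u} ws no-au no-xu no-xa
    with replicate-prefix ws (λ { (inj₁ refl) → no-au ; (inj₂ refl) → no-xu })
  ... | i , L′ , refl , ws′ with replicate-prefix ws′ (λ { refl → no-xa ∘ ++⁺ˡ (replicate i u) })
  ... | j , L″ , refl , ws″ =
    i , j , length L″ , cong (λ L → replicate i u ++ replicate j _ ++ L) (All≡⇒replicate ws″)

  TopColor-++ : {a : A} (V : List A) {W : List A} → TopColor a W → TopColor a (V ++ W)
  TopColor-++ {a} V (T , eq) = V ++ T , trans (cong (V ++_) eq) (sym (++-assoc V T [ a ]))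

  TopColor-replicate : {a : A} (j : ℕ) → TopColor a (replicate (suc j) a)
  TopColor-replicate zero = [] , refl
  TopColor-replicate {a} (suc j) = let T , eq = TopColor-replicate j in a ∷ T , cong (a ∷_) eq

  above-non-top : {a : A} {xs S : List A} → ¬ TopColor a S → xs ++ [ a ] ⊆ S →
    ∃ λ t → t ≢ a × (xs ++ [ a ]) ++ [ t ] ⊆ S
  above-non-top {S = S} not-top p with initLast S
  above-non-top {xs = []} not-top () | []
  above-non-top {xs = _ ∷ _} not-top () | []
  ... | T ∷ʳ′ t = t , t≢a , ++⁺ (∷ʳ-⊆-∷ʳ⁻ (≢-sym t≢a) p) ⊆-refl
    where
    t≢a : t ≢ _
    t≢a refl = not-top (T , refl)

module _ {C : Set} (_≟_ : DecidableEquality C) where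

  open import Data.List.Relation.Binary.Sublist.DecPropositional _≟_ using (_⊆?_)
  open import Data.List.Membership.DecPropositional _≟_ using (_∈?_)

  erase : C → List C → List C
  erase a = filter (λ c → ¬? (c ≟ a))

  Exposed : C → List C → Set
  Exposed x S = ∀ w → w ≢ x → ¬ ((x ∷ w ∷ []) ⊆ S)

  ⊆-erase : {a : C} {L S : List C} → All (_≢ a) L → L ⊆ S → L ⊆ erase a S
  ⊆-erase {a} {S = S} L≢a p =
    subst (_⊆ erase a S) (filter-all (λ c → ¬? (c ≟ a)) L≢a) (filter⁺ _ _ (λ { refl q → q }) p)

  ⊆-erase-++ : {a : C} {L S R : List C} → All (_≢ a) L → L ⊆ S ++ R → L ⊆ erase a S ++ R
  ⊆-erase-++ {a} {S = S} {R} L≢a p = ⊆-trans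
    (subst (_ ⊆_) (filter-++ (λ c → ¬? (c ≟ a)) S R) (⊆-erase L≢a p))
    (++⁺ ⊆-refl (filter-⊆ _ R))

  blocked? : (z : C) (W : List C) → Dec (Blocked z W)
  blocked? z W = ∃-∈? W
    (λ u → ∃-∈? W
      (λ v → ¬? (u ≟ v) ×-dec ¬? (z ≟ u) ×-dec ¬? (z ≟ v) ×-dec (u ∷ v ∷ u ∷ z ∷ []) ⊆? W)
      (λ (_ , _ , _ , p) → lookup p (there (here refl))))
    (λ (_ , _ , _ , _ , p) → lookup p (here refl))

  unsortable-exposed⇒blocked : {x : C} {S R : List C} → Unsortable x S R → Exposed x S →
    x ∈ R × Blocked x (S ++ R)
  unsortable-exposed⇒blocked {x} {S} {R} (x∈SR , unsortable) exposed =
    decidable-stable (x ∈? R ×-dec blocked? x (S ++ R))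
      (λ not-blocked → unsortable (x∈SR , exposed , curry not-blocked))

  exposed-after-erase : {a x : C} {S : List C} → x ≢ a → ¬ ContainsSandwich S → ¬ TopColor a S →
    Exposed x (erase a S) → Exposed x S
  exposed-after-erase {a} {x} x≢a no-sandwich not-top exposed′ w w≢x xw with w ≟ a
  ... | no w≢a = exposed′ w w≢x (⊆-erase (x≢a ∷ w≢a ∷ []) xw)
  ... | yes refl with above-non-top {xs = [ x ]} not-top xw
  ... | t , t≢a , xat with t ≟ x
  ... | yes refl = no-sandwich (t , w , x≢a , xat)
  ... | no t≢x = exposed′ t t≢x (⊆-erase (x≢a ∷ t≢a ∷ []) (⊆-trans (refl ∷ _ ∷ʳ refl ∷ []) xat))

  sandwich-split : {u v x : C} {S R : List C} → ¬ ContainsSandwich S → u ≢ v →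
    (u ∷ v ∷ u ∷ x ∷ []) ⊆ S ++ R →
    (v ∷ u ∷ x ∷ []) ⊆ R ⊎ (u ∷ v ∷ []) ⊆ S × (u ∷ x ∷ []) ⊆ R
  sandwich-split {S = S} no-sandwich u≢v p with ⊆-++-split S p
  ... | [] , _ , refl , _ , uvux = inj₁ (∷ˡ⁻ uvux)
  ... | _ ∷ [] , _ , refl , _ , vux = inj₁ vux
  ... | _ ∷ _ ∷ [] , _ , refl , uv , ux = inj₂ (uv , ux)
  ... | _ ∷ _ ∷ _ ∷ [] , _ , refl , uvu , _ = ⊥-elim (no-sandwich (_ , _ , u≢v , uvu))
  ... | _ ∷ _ ∷ _ ∷ _ ∷ [] , _ , refl , uvux , _ =
    ⊥-elim (no-sandwich (_ , _ , u≢v , ⊆-trans (refl ∷ refl ∷ refl ∷ _ ∷ʳ []) uvux))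
  ... | _ ∷ _ ∷ _ ∷ _ ∷ _ ∷ _ , _ , () , _ , _

  unblocked⇒colors-above : {a u x : C} {S R : List C} → u ≢ a → x ≢ u → (u ∷ x ∷ []) ⊆ R →
    ¬ Blocked x (erase a S ++ R) →
    ∀ {w} → (u ∷ w ∷ []) ⊆ S → w ≡ u ⊎ w ≡ a ⊎ w ≡ x
  unblocked⇒colors-above {a} {u} {x} u≢a x≢u ux unblocked {w} uw with w ≟ u | w ≟ a | w ≟ x
  ... | yes w≡u | _ | _ = inj₁ w≡u
  ... | no _ | yes w≡a | _ = inj₂ (inj₁ w≡a)
  ... | no _ | no _ | yes w≡x = inj₂ (inj₂ w≡x)
  ... | no w≢u | no w≢a | no w≢x =
    ⊥-elim (unblocked (u , w , ≢-sym w≢u , x≢u , ≢-sym w≢x , ++⁺ (⊆-erase (u≢a ∷ w≢a ∷ []) uw) ux))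

  top-three : {u a x : C} {S : List C} → u ≢ a → u ≢ x → x ≢ a →
    ¬ ContainsSandwich S → Exposed x S → ¬ TopColor a S →
    (∀ {w} → (u ∷ w ∷ []) ⊆ S → w ≡ u ⊎ w ≡ a ⊎ w ≡ x) →
    (u ∷ a ∷ []) ⊆ S → TopThree u a x S
  top-three {u} {a} u≢a u≢x x≢a no-sandwich exposed not-top above-u ua
    with ∷-⊆-split ua
  ... | T , Rest , refl , a∈Rest
    with three-blocks (All.tabulate (λ w∈Rest → above-u (++⁺ˡ T (refl ∷ from∈ w∈Rest))))
           (λ au → no-sandwich (u , a , u≢a , ++⁺ˡ T (refl ∷ au)))
           (λ xu → exposed u u≢x (++⁺ˡ T (u ∷ʳ xu)))
           (λ xa → exposed a (≢-sym x≢a) (++⁺ˡ T (u ∷ʳ xa)))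
  ... | i , zero , k , refl =
    ⊥-elim (All.lookup (All-++⁺ (replicate⁺ i u≢a) (replicate⁺ k x≢a)) (to∈ a∈Rest) refl)
  ... | i , suc j , zero , refl = ⊥-elim (not-top (TopColor-++ T (TopColor-++ (replicate (suc i) u)
    (subst (TopColor a) (sym (++-identityʳ (replicate (suc j) a))) (TopColor-replicate j)))))
  ... | i , suc j , suc k , refl = T , i , j , k , refl

  unblocked-by-erasure : {a x : C} {S R : List C} → x ≢ a →
    ¬ ContainsSandwich S → Exposed x S → ¬ TopColor a S →
    Blocked x (S ++ R) → ¬ Blocked x (erase a S ++ R) →
    (a ∷ x ∷ []) ⊆ R ⊎ (∃ λ y → y ≢ a × y ≢ x × (y ∷ x ∷ []) ⊆ R × TopThree y a x S)
  unblocked-by-erasure {a} {S = S} x≢a no-sandwich exposed not-top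
    (u , v , u≢v , x≢u , x≢v , uvux) unblocked
    with u ≟ a | v ≟ a | sandwich-split no-sandwich u≢v uvux
  ... | yes refl | _ | inj₁ vax = inj₁ (∷ˡ⁻ vax)
  ... | yes refl | _ | inj₂ (_ , ax) = inj₁ ax
  ... | no _ | yes refl | inj₁ aux = inj₁ (⊆-trans (refl ∷ _ ∷ʳ refl ∷ []) aux)
  ... | no u≢a | yes refl | inj₂ (ua , ux) =
    inj₂ (u , u≢a , ≢-sym x≢u , ux , top-three u≢a (≢-sym x≢u) x≢a no-sandwich exposed not-top
      (unblocked⇒colors-above u≢a x≢u ux unblocked) ua)
  ... | no u≢a | no v≢a | _ =
    ⊥-elim (unblocked (u , v , u≢v , x≢u , x≢v , ⊆-erase-++ {S = S} (u≢a ∷ v≢a ∷ u≢a ∷ x≢a ∷ []) uvux))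

lemma4p4 : {C : Set} (_≟_ : DecidableEquality C) (S R : List C) (a x : C) →
    TwoColors S → ¬ ContainsSandwich S → a ∈ S → ¬ TopColor a S →
    Unsortable x S R →
    Sortable x (filter (λ c → ¬? (c ≟ a)) S) R →
    (x ≡ a)
    ⊎ ((a ∷ x ∷ []) ⊆ R)
    ⊎ (∃ λ y → y ≢ a × y ≢ x × (y ∷ x ∷ []) ⊆ R × TopThree y a x S)
lemma4p4 _≟_ S R a x _ no-sandwich _ not-top unsortable (_ , exposed′ , unblocked′) with x ≟ a
... | yes x≡a = inj₁ x≡a
... | no x≢a =
  let exposed = exposed-after-erase _≟_ x≢a no-sandwich not-top exposed′
      x∈R , blocked = unsortable-exposed⇒blocked _≟_ unsortable exposed
  in inj₂ (unblocked-by-erasure _≟_ x≢a no-sandwich exposed not-top blocked (unblocked′ x∈R))
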